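{- The set $\mathrm{Diag}\,\mathbb P=\{p^{(k)}_k: k\in\mathbb N\}$ is not (R)-dense. Moreover, $$\lim_{k\to+\infty}\frac{p^{(k+1)}_{k+1}}{p^{(k)}_k}=+\infty,$$ and every point of $R(\mathrm{Diag}\,\mathbb P)$ is isolated; more precisely, $R^d(\mathrm{Diag}\,\mathbb P)\cap(0,+\infty)=\emptyset$.
   Context: Let $p_n$ denote the $n$-th prime number ($p_1=2$). Define $p^{(0)}_n=n$ and recursively $p^{(k+1)}_n=p_{p^{(k)}_n}$ for $k\in\mathbb N_0$. For $A\subset\mathbb N$, its ratio set is $R(A)=\{a/b: a,b\in A\}$, and $A$ is called (R)-dense if $R(A)$ is dense in $(0,+\infty)$. For $B\subset(0,+\infty)$, $B^d$ denotes the set of accumulation points of $B$ in $(0,+\infty)$; $R^d(A)$ means $(R(A))^d$. -}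

module Defs where

open import Data.Nat using (ℕ; zero; suc; _∸_; _!; _≤_)
open import Data.Integer using (+_)
open import Data.Product using (Σ; ∃; _×_)
open import Relation.Nullary using (yes; no)
open import Relation.Binary.PropositionalEquality using (_≡_)
open import Data.Nat.Primality using (prime?)
open import Data.Rational.Unnormalised.Base
  using (ℚᵘ; mkℚᵘ; 0ℚᵘ; ∣_∣; _-_; _+_)
  renaming (_<_ to _<ℚ_; _≤_ to _≤ℚ_; _≃_ to _≃ℚ_)

-- Primes.
-- search f m : first prime among m, m+1, …, m+f (junk value if none).
search : ℕ → ℕ → ℕ
search zero    m = m
search (suc f) m with prime? m
... | yes _ = m
... | no  _ = search f (suc m)

-- Smallest prime > m (the fuel m ! + 1 suffices by Euclid's argument).
nextPrime : ℕ → ℕ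
nextPrime m = search (suc (m !)) (suc m)

-- p n = p_n, the n-th prime, p 1 = 2 (p 0 is an unused junk value).
p : ℕ → ℕ
p zero          = 0
p (suc zero)    = 2
p (suc (suc n)) = nextPrime (p (suc n))

iter : ℕ → ℕ → ℕ
iter zero    n = n
iter (suc k) n = p (iter k n)

diag : ℕ → ℕ
diag k = iter k k

Diag : ℕ → Set
Diag a = ∃ λ k → 1 ≤ k × a ≡ diag k

-- Rationals: ratio a b = a / b  (used only with b ≥ 1).
ratio : ℕ → ℕ → ℚᵘ
ratio a b = mkℚᵘ (+ a) (b ∸ 1)

inv : ℕ → ℚᵘ
inv n = mkℚᵘ (+ 1) n

-- Ratio set R(A) ⊆ ℚ ⊆ ℝ, as a predicate on rationals.
RatioSet : (ℕ → Set) → ℚᵘ → Set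
RatioSet A q = Σ ℕ λ a → Σ ℕ λ b → A a × A b × q ≃ℚ ratio a b

-- Real numbers (Bishop): regular Cauchy sequences of rationals.
record ℝ : Set where
  field
    seq : ℕ → ℚᵘ
    reg : ∀ m n → ∣ seq m - seq n ∣ ≤ℚ inv m + inv n
open ℝ public

Positive : ℝ → Set
Positive x = ∃ λ n → inv n <ℚ seq x n

-- |b - x| < ε for rational b, ε: the regular sequence
-- n ↦ ε - |b - x_n| represents ε - |b - x|, and we ask it be positive.
DistLt : ℚᵘ → ℝ → ℚᵘ → Set
DistLt b x ε = ∃ λ n → inv n <ℚ (ε - ∣ b - seq x n ∣)

Apart : ℚᵘ → ℝ → Set
Apart b x = ∃ λ n → inv n <ℚ ∣ b - seq x n ∣

DenseInPos : (ℚᵘ → Set) → Set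
DenseInPos B = (x : ℝ) → Positive x → (ε : ℚᵘ) → 0ℚᵘ <ℚ ε →
               ∃ λ b → B b × DistLt b x ε

RDense : (ℕ → Set) → Set
RDense A = DenseInPos (RatioSet A)

AccPoint : (ℚᵘ → Set) → ℝ → Set
AccPoint B x = Positive x × ((ε : ℚᵘ) → 0ℚᵘ <ℚ ε →
               ∃ λ b → B b × Apart b x × DistLt b x ε)

{-# OPTIONS --safe #-}
-- p n / n → ∞ by a Chebyshev-type count: the primes in (N, 2N] all divide the central
-- binomial coefficient (2N choose N) ≤ 4 ^ N, so once N ≥ 4 ^ c there are at most N / c of
-- them, and summing over the dyadic scales 2 ^ i · 4 ^ c gives c · n ≤ c · 4 ^ c + 2 · p n.
-- As p (diag k) < diag (1 + k), consecutive diagonal terms then grow by unbounded factors,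
-- so two diagonal terms within a bounded factor of each other are equal or have bounded
-- indices. Hence the ratios in R(Diag ℙ) lying in a compact [lo, hi] ⊂ (0, ∞) have bounded
-- denominators and are uniformly separated; a set with that property has no accumulation
-- point in (0, ∞), all its points are isolated, and it is not dense.
module Submission where

open import Defs

module Primes where

  open import Data.Nat
  open import Data.Nat.Properties
  open import Data.Nat.Divisibility
  open import Data.Nat.Primality
  open import Data.Nat.Primality.Factorisation using (PrimeFactorisation; factorise)
  open import Data.Nat.ListAction using (product)
  open import Data.Nat.Combinatorics using (_C_; k![n∸k]!∣n!; nCk+nC[k+1]≡[n+1]C[k+1])
  open import Data.Nat.Combinatorics.Specification using (nCk≡n!/k![n-k]!)
  open import Data.Nat.DivMod using (m/n*n≡m)
  open import Data.List using (List; []; _∷_)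
  open import Data.List.Relation.Unary.All using (All; []; _∷_)
  open import Data.Product using (∃; _×_; _,_; proj₁; proj₂)
  open import Data.Sum using (_⊎_; inj₁; inj₂; [_,_]′)
  open import Data.Empty using (⊥-elim)
  open import Relation.Nullary using (¬_; yes; no; contradiction)
  open import Relation.Binary.PropositionalEquality
  open import Relation.Binary.Definitions using (tri<; tri≈; tri>)

  prime⇒2≤ : ∀ {q} → Prime q → 2 ≤ q
  prime⇒2≤ {q} pq = nonTrivial⇒n>1 q ⦃ prime⇒nonTrivial pq ⦄

  ∃-prime-divisor : ∀ n → 2 ≤ n → ∃ λ q → Prime q × q ∣ n
  ∃-prime-divisor n@(suc _) 2≤n = go (factors F) (sym (isFactorisation F)) (factorsPrime F)
    where
    open PrimeFactorisation
    F = factorise n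
    go : (qs : List ℕ) → product qs ≡ n → All Prime qs → ∃ λ q → Prime q × q ∣ n
    go []       1≡n _        = contradiction 1≡n (<⇒≢ 2≤n)
    go (q ∷ qs) eq  (pq ∷ _) = q , pq , divides (product qs) (trans (sym eq) (*-comm q (product qs)))

  prime∤1 : ∀ {q} → Prime q → ¬ q ∣ 1
  prime∤1 pq q∣1 = <⇒≢ (prime⇒2≤ pq) (sym (∣1⇒≡1 q∣1))

  prime∤! : ∀ {q} → Prime q → ∀ {N} → N < q → ¬ q ∣ N !
  prime∤! pq {zero}  _   = prime∤1 pq
  prime∤! pq {suc N} N<q q∣ with euclidsLemma (suc N) (N !) pq q∣
  ... | inj₁ q∣1+N = <⇒≱ N<q (∣⇒≤ q∣1+N)
  ... | inj₂ q∣N!  = prime∤! pq (<-trans (n<1+n N) N<q) q∣N!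

  ∣! : ∀ {a b} → 1 ≤ a → a ≤ b → a ∣ b !
  ∣! {suc a} _ a≤b = ∣-trans (m∣m*n (a !)) (m≤n⇒m!∣n! a≤b)

  -- Euclid: every prime factor of m ! + 1 exceeds m.
  euclid-prime : ∀ m → ∃ λ q → Prime q × m < q × q ≤ suc (m !)
  euclid-prime m with ∃-prime-divisor (suc (m !)) (s≤s (1≤n! m))
  ... | q , pq , q∣ = q , pq , ≰⇒> q≰m , ∣⇒≤ q∣
    where
    q≰m : ¬ q ≤ m
    q≰m q≤m = prime∤1 pq (∣m+n∣m⇒∣n (subst (q ∣_) (+-comm 1 (m !)) q∣) (∣! (<-trans (n<1+n 0) (prime⇒2≤ pq)) q≤m))

  search-≥ : ∀ f m → m ≤ search f m
  search-≥ zero    m = ≤-refl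
  search-≥ (suc f) m with prime? m
  ... | yes _ = ≤-refl
  ... | no  _ = ≤-trans (n≤1+n m) (search-≥ f (suc m))

  search-prime : ∀ f m {q} → Prime q → m ≤ q → q ≤ f + m → Prime (search f m)
  search-prime zero    m pq m≤q q≤m rewrite ≤-antisym q≤m m≤q = pq
  search-prime (suc f) m {q} pq m≤q q≤f+m with prime? m
  ... | yes pm = pm
  ... | no ¬pm = search-prime f (suc m) pq (≤∧≢⇒< m≤q m≢q) (≤-trans q≤f+m (≤-reflexive (sym (+-suc f m))))
    where
    m≢q : m ≢ q
    m≢q refl = ¬pm pq

  p-prime : ∀ n → Prime (p (suc n))
  p-prime zero    = prime[2]
  p-prime (suc n) with euclid-prime (p (suc n))
  ... | q , pq , p[1+n]<q , q≤ = search-prime (suc (p (suc n) !)) (suc (p (suc n))) pq p[1+n]<q (≤-trans q≤ (m≤m+n _ _))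

  p-<-suc : ∀ n → p n < p (suc n)
  p-<-suc zero    = s≤s z≤n
  p-<-suc (suc n) = search-≥ (suc (p (suc n) !)) (suc (p (suc n)))

  module StrictlyIncreasing (f : ℕ → ℕ) (f-<-suc : ∀ n → f n < f (suc n)) where

    strictMono : ∀ {m n} → m < n → f m < f n
    strictMono {m} {suc n} m<1+n with m≤n⇒m<n∨m≡n (≤-pred m<1+n)
    ... | inj₁ m<n  = <-trans (strictMono m<n) (f-<-suc n)
    ... | inj₂ refl = f-<-suc m

    mono : ∀ {m n} → m ≤ n → f m ≤ f n
    mono m≤n with m≤n⇒m<n∨m≡n m≤n
    ... | inj₁ m<n  = <⇒≤ (strictMono m<n)
    ... | inj₂ refl = ≤-refl

    n≤f : ∀ n → n ≤ f n
    n≤f zero    = z≤n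
    n≤f (suc n) = ≤-<-trans (n≤f n) (f-<-suc n)

  open StrictlyIncreasing p p-<-suc public
    renaming (strictMono to p-strictMono; mono to p-mono; n≤f to n≤p)

  -- Chebyshev's bound

  nCk≤2^n : ∀ n k → n C k ≤ 2 ^ n
  nCk≤2^n zero    zero    = ≤-refl
  nCk≤2^n zero    (suc k) = z≤n
  nCk≤2^n (suc n) zero    = m^n>0 2 (suc n)
  nCk≤2^n (suc n) (suc k) = begin
    suc n C suc k           ≡⟨ nCk+nC[k+1]≡[n+1]C[k+1] n k ⟨
    n C k + n C suc k       ≤⟨ +-mono-≤ (nCk≤2^n n k) (≤-trans (nCk≤2^n n (suc k)) (m≤m+n _ 0)) ⟩
    2 ^ suc n               ∎
    where open ≤-Reasoning

  n!≡nCk*k![n∸k]! : ∀ {n k} → k ≤ n → n ! ≡ (n C k) * (k ! * (n ∸ k) !)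
  n!≡nCk*k![n∸k]! {n} {k} k≤n = begin
    n !                                          ≡⟨ m/n*n≡m (k![n∸k]!∣n! k≤n) ⟨
    n ! / (k ! * (n ∸ k) !) * (k ! * (n ∸ k) !)  ≡⟨ cong (_* (k ! * (n ∸ k) !)) (nCk≡n!/k![n-k]! k≤n) ⟨
    (n C k) * (k ! * (n ∸ k) !)                  ∎
    where
    open ≡-Reasoning
    instance _ = k !* (n ∸ k) !≢0

  central-binomial : ∀ N → (N + N) ! ≡ ((N + N) C N) * (N ! * N !)
  central-binomial N = subst (λ m → (N + N) ! ≡ ((N + N) C N) * (N ! * m !)) (m+n∸m≡n N N) (n!≡nCk*k![n∸k]! (m≤m+n N N))

  central-binomial≤4^N : ∀ N → (N + N) C N ≤ 4 ^ N
  central-binomial≤4^N N = ≤-trans (nCk≤2^n (N + N) N) (≤-reflexive (begin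
    2 ^ (N + N)      ≡⟨ cong (λ m → 2 ^ (N + m)) (+-identityʳ N) ⟨
    2 ^ (2 * N)      ≡⟨ ^-*-assoc 2 2 N ⟨
    4 ^ N            ∎))
    where open ≡-Reasoning

  prime∤larger-prime : ∀ {r q} → Prime r → Prime q → r < q → ¬ r ∣ q
  prime∤larger-prime pr pq r<q r∣q with prime⇒irreducible pq r∣q
  ... | inj₁ r≡1 = <⇒≢ (prime⇒2≤ pr) (sym r≡1)
  ... | inj₂ r≡q = <⇒≢ r<q r≡q

  -- The primes p (1 + a), …, p (t + a) are distinct, so their product, at least (1 + N) ^ t, divides Y.
  prime-divisors-bound : ∀ {N} a t Y → .{{NonZero Y}} →
    (∀ j → j < t → N < p (suc (a + j)) × p (suc (a + j)) ∣ Y) → suc N ^ t ≤ Y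
  prime-divisors-bound a zero    Y h = >-nonZero⁻¹ Y
  prime-divisors-bound {N} a (suc t) Y h = begin
    suc N * suc N ^ t  ≤⟨ *-mono-≤ N<q (prime-divisors-bound a t Y/q h/q) ⟩
    q * Y/q            ≡⟨ m∣n⇒n≡m*quotient q∣Y ⟨
    Y                  ∎
    where
    open ≤-Reasoning
    q = p (suc (a + t))
    N<q = proj₁ (h t ≤-refl)
    q∣Y = proj₂ (h t ≤-refl)
    Y/q = quotient q∣Y
    instance _ = quotient≢0 q∣Y
    h/q : ∀ j → j < t → N < p (suc (a + j)) × p (suc (a + j)) ∣ Y/q
    h/q j j<t with h j (m<n⇒m<1+n j<t)
    ... | N<r , r∣Y with euclidsLemma q Y/q (p-prime (a + j)) (subst (_ ∣_) (m∣n⇒n≡m*quotient q∣Y) r∣Y)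
    ... | inj₁ r∣q   = contradiction r∣q (prime∤larger-prime (p-prime (a + j)) (p-prime (a + t)) (p-strictMono (s≤s (+-monoʳ-< a j<t))))
    ... | inj₂ r∣Y/q = N<r , r∣Y/q

  -- Every prime in (N, 2N] divides the central binomial coefficient, which is at most 4 ^ N.
  chebyshev : ∀ {N} a t → N < p (suc a) → p (a + t) ≤ N + N → suc N ^ t ≤ 4 ^ N
  chebyshev {N} a t N<p[1+a] p[a+t]≤2N =
    ≤-trans (prime-divisors-bound a t ((N + N) C N) divides-binomial) (central-binomial≤4^N N)
    where
    instance
      _ : NonZero ((N + N) C N)
      _ = m*n≢0⇒m≢0 ((N + N) C N) ⦃ subst NonZero (central-binomial N) ((N + N) !≢0) ⦄
    divides-binomial : ∀ j → j < t → N < p (suc (a + j)) × p (suc (a + j)) ∣ (N + N) C N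
    divides-binomial j j<t = N<r , r∣C
      where
      r = p (suc (a + j))
      pr = p-prime (a + j)
      N<r : N < r
      N<r = <-≤-trans N<p[1+a] (p-mono (s≤s (m≤m+n a j)))
      r∣[2N]! : r ∣ ((N + N) C N) * (N ! * N !)
      r∣[2N]! = subst (r ∣_) (central-binomial N)
                  (∣! (<-trans (n<1+n 0) (prime⇒2≤ pr)) (≤-trans (p-mono (+-monoʳ-< a j<t)) p[a+t]≤2N))
      r∣C : r ∣ (N + N) C N
      r∣C with euclidsLemma ((N + N) C N) (N ! * N !) pr r∣[2N]!
      ... | inj₁ r∣C    = r∣C
      ... | inj₂ r∣N!N! = ⊥-elim ([ prime∤! pr N<r , prime∤! pr N<r ]′ (euclidsLemma (N !) (N !) pr r∣N!N!))

  -- Growth of p and of the diagonal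

  dyadic-prime-count : ∀ c {N} a t → 4 ^ c ≤ N → N < p (suc a) → p (a + t) ≤ N + N → c * t ≤ N
  dyadic-prime-count c a zero    _ _ _ = ≤-trans (≤-reflexive (*-zeroʳ c)) z≤n
  dyadic-prime-count c {N} a t@(suc _) 4^c≤N N<p[1+a] p[a+t]≤2N = ≮⇒≥ λ N<ct → <-irrefl refl (begin-strict
    suc N ^ t    ≤⟨ chebyshev a t N<p[1+a] p[a+t]≤2N ⟩
    4 ^ N        <⟨ ^-monoʳ-< 4 (s≤s (s≤s z≤n)) N<ct ⟩
    4 ^ (c * t)  ≡⟨ ^-*-assoc 4 c t ⟨
    (4 ^ c) ^ t  ≤⟨ ^-monoˡ-≤ t 4^c≤N ⟩
    N ^ t        <⟨ ^-monoˡ-< t (n<1+n N) ⟩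
    suc N ^ t    ∎)
    where open ≤-Reasoning

  ∃-last-index : ∀ N b → ∃ λ a → a ≤ b × p a ≤ N × (a < b → N < p (suc a))
  ∃-last-index N zero = 0 , z≤n , z≤n , λ ()
  ∃-last-index N (suc b) with p (suc b) ≤? N
  ... | yes p[1+b]≤N = suc b , ≤-refl , p[1+b]≤N , λ b<b → contradiction b<b (<-irrefl refl)
  ... | no  p[1+b]≰N with ∃-last-index N b
  ... | a , a≤b , p[a]≤N , next = a , m≤n⇒m≤1+n a≤b , p[a]≤N , next′
    where
    next′ : a < suc b → N < p (suc a)
    next′ _ with m≤n⇒m<n∨m≡n a≤b
    ... | inj₁ a<b  = next a<b
    ... | inj₂ refl = ≰⇒> p[1+b]≰N

  -- A bound  p b ≤ N → c * b ≤ …  is a bound on c · π(N), π the prime-counting function.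
  index-bound-doubling : ∀ c {N B} → 4 ^ c ≤ N → (∀ a → p a ≤ N → c * a ≤ B + N) →
                         ∀ b → p b ≤ N + N → c * b ≤ B + (N + N)
  index-bound-doubling c {N} {B} 4^c≤N bound b p[b]≤2N with ∃-last-index N b
  ... | a , a≤b , p[a]≤N , next with m≤n⇒m<n∨m≡n a≤b
  ... | inj₂ refl = ≤-trans (bound a p[a]≤N) (+-monoʳ-≤ B (m≤m+n N N))
  ... | inj₁ a<b  = begin
    c * b                ≡⟨ cong (c *_) b≡a+t ⟩
    c * (a + t)          ≡⟨ *-distribˡ-+ c a t ⟩
    c * a + c * t        ≤⟨ +-mono-≤ (bound a p[a]≤N) (dyadic-prime-count c a t 4^c≤N (next a<b) p[a+t]≤2N) ⟩
    B + N + N            ≡⟨ +-assoc B N N ⟩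
    B + (N + N)          ∎
    where
    open ≤-Reasoning
    t = b ∸ a
    b≡a+t = sym (m+[n∸m]≡n a≤b)
    p[a+t]≤2N = subst (λ m → p m ≤ N + N) b≡a+t p[b]≤2N

  index-bound : ∀ c i b → p b ≤ 2 ^ i * 4 ^ c → c * b ≤ c * 4 ^ c + 2 ^ i * 4 ^ c
  index-bound c zero b p[b]≤X =
    ≤-trans (*-monoʳ-≤ c (≤-trans (n≤p b) (≤-trans p[b]≤X (≤-reflexive (*-identityˡ _))))) (m≤m+n _ _)
  index-bound c (suc i) b p[b]≤2N = subst (λ M → c * b ≤ c * 4 ^ c + M) (sym 2^[1+i]X≡N+N)
    (index-bound-doubling c (m≤n*m (4 ^ c) (2 ^ i) ⦃ m^n≢0 2 i ⦄) (index-bound c i) b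
      (subst (p b ≤_) 2^[1+i]X≡N+N p[b]≤2N))
    where
    N = 2 ^ i * 4 ^ c
    2^[1+i]X≡N+N : 2 ^ suc i * 4 ^ c ≡ N + N
    2^[1+i]X≡N+N = trans (*-assoc 2 (2 ^ i) (4 ^ c)) (cong (N +_) (+-identityʳ N))

  n<2^n : ∀ n → n < 2 ^ n
  n<2^n zero    = s≤s z≤n
  n<2^n (suc n) = +-mono-≤ (m^n>0 2 n) (≤-trans (n<2^n n) (m≤m+n _ 0))

  -- Apply index-bound at the dyadic scale 2 ^ i * 4 ^ c just below p n.
  index-bound-by-p : ∀ c n → 4 ^ c < p n → c * n ≤ c * 4 ^ c + 2 * p n
  index-bound-by-p c n X<p[n] = go (p n) X<p[n] (≤-trans (<⇒≤ (n<2^n (p n))) (m≤m*n _ X ⦃ m^n≢0 4 c ⦄))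
    where
    X = 4 ^ c
    go : ∀ i → X < p n → p n ≤ 2 ^ i * X → c * n ≤ c * X + 2 * p n
    go zero    X<p[n] p[n]≤X = contradiction (subst (p n ≤_) (*-identityˡ X) p[n]≤X) (<⇒≱ X<p[n])
    go (suc i) X<p[n] p[n]≤  with p n ≤? 2 ^ i * X
    ... | yes p[n]≤2^iX = go i X<p[n] p[n]≤2^iX
    ... | no  p[n]≰2^iX = ≤-trans (index-bound c (suc i) n p[n]≤) (+-monoʳ-≤ (c * X) (begin
      2 ^ suc i * X    ≡⟨ *-assoc 2 (2 ^ i) X ⟩
      2 * (2 ^ i * X)  ≤⟨ *-monoʳ-≤ 2 (<⇒≤ (≰⇒> p[n]≰2^iX)) ⟩
      2 * p n          ∎))
      where open ≤-Reasoning

  p-superlinear : ∀ m → ∃ λ n₀ → ∀ n → n₀ ≤ n → m * n ≤ p n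
  p-superlinear m = suc (c * X) , λ n cX<n → *-cancelˡ-≤ 2 (+-cancelˡ-≤ n _ _ (begin
    n + 2 * (m * n)  ≡⟨ cong (n +_) (*-assoc 2 m n) ⟨
    c * n            ≤⟨ index-bound-by-p c n (<-≤-trans (≤-<-trans (m≤n*m X c) cX<n) (n≤p n)) ⟩
    c * X + 2 * p n  ≤⟨ +-monoˡ-≤ (2 * p n) (<⇒≤ cX<n) ⟩
    n + 2 * p n      ∎))
    where
    open ≤-Reasoning
    c = suc (2 * m)
    X = 4 ^ c

  iter-strictMono : ∀ k {m n} → m < n → iter k m < iter k n
  iter-strictMono zero    m<n = m<n
  iter-strictMono (suc k) m<n = p-strictMono (iter-strictMono k m<n)

  p[diag]<diag-suc : ∀ k → p (diag k) < diag (suc k)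
  p[diag]<diag-suc k = p-strictMono (iter-strictMono k (n<1+n k))

  diag-<-suc : ∀ k → diag k < diag (suc k)
  diag-<-suc k = ≤-<-trans (n≤p (diag k)) (p[diag]<diag-suc k)

  open StrictlyIncreasing diag diag-<-suc public
    using () renaming (mono to diag-mono; n≤f to n≤diag)

  Diag⇒≥1 : ∀ {a} → Diag a → 1 ≤ a
  Diag⇒≥1 (k , 1≤k , refl) = ≤-trans 1≤k (n≤diag k)

  diag-growth : ∀ U → ∃ λ K → ∀ k → K ≤ k → U * diag k < diag (suc k)
  diag-growth U with p-superlinear (suc U)
  ... | n₀ , superlinear = n₀ , λ k n₀≤k → begin-strict
    U * diag k      ≤⟨ *-monoˡ-≤ (diag k) (n≤1+n U) ⟩
    suc U * diag k  ≤⟨ superlinear (diag k) (≤-trans n₀≤k (n≤diag k)) ⟩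
    p (diag k)      <⟨ p[diag]<diag-suc k ⟩
    diag (suc k)    ∎
    where open ≤-Reasoning

  diag-comparable : ∀ U → ∃ λ K → ∀ i j → diag i ≤ U * diag j → diag j ≤ U * diag i → i ≡ j ⊎ j ≤ K
  diag-comparable U with diag-growth U
  ... | K , growth = K , comparable
    where
    gap : ∀ {i j} → i < j → diag j ≤ U * diag i → j ≤ K
    gap {i} {suc j} (s≤s i≤j) d[1+j]≤Ud[i] =
      ≰⇒> λ K≤j → <⇒≱ (≤-<-trans (*-monoʳ-≤ U (diag-mono i≤j)) (growth j K≤j)) d[1+j]≤Ud[i]
    comparable : ∀ i j → diag i ≤ U * diag j → diag j ≤ U * diag i → i ≡ j ⊎ j ≤ K
    comparable i j d[i]≤ d[j]≤ with <-cmp i j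
    ... | tri< i<j _ _ = inj₂ (gap i<j d[j]≤)
    ... | tri≈ _ i≡j _ = inj₁ i≡j
    ... | tri> _ _ j<i = inj₂ (≤-trans (<⇒≤ j<i) (gap j<i d[i]≤))

module Rationals where

  open import Data.Nat as ℕ using (suc; s≤s; z≤n)
  import Data.Nat.Properties as ℕₚ
  open import Data.Nat.Tactic.RingSolver using (solve-∀)
  open import Data.Integer as ℤ using (+_; +[1+_]; -[1+_])
  import Data.Integer.Properties as ℤₚ
  open import Data.Rational.Unnormalised.Base
    using (ℚᵘ; mkℚᵘ; *≡*; *≤*; *<*; 0ℚᵘ; ∣_∣; -_; _+_; _-_; _≃_; _≤_; _<_; _⊓_)
  open import Data.Rational.Unnormalised.Properties
  open import Data.Rational.Unnormalised.Solver using (module +-*-Solver)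
  open +-*-Solver
  open import Data.Product using (∃; _×_; _,_)
  open import Data.Sum using (inj₁; inj₂)
  open import Relation.Nullary using (¬_)
  open import Relation.Binary.PropositionalEquality using (_≡_; sym; cong; cong₂; subst; subst₂; module ≡-Reasoning)

  ∣p-r∣≤∣p-q∣+∣q-r∣ : ∀ p q r → ∣ p - r ∣ ≤ ∣ p - q ∣ + ∣ q - r ∣
  ∣p-r∣≤∣p-q∣+∣q-r∣ p q r =
    ≤-respˡ-≃ (∣-∣-cong (solve 3 (λ p q r → (p :- q) :+ (q :- r) := p :- r) ≃-refl p q r))
              (∣p+q∣≤∣p∣+∣q∣ (p - q) (q - r))

  ∣p-q∣≃∣q-p∣ : ∀ p q → ∣ p - q ∣ ≃ ∣ q - p ∣
  ∣p-q∣≃∣q-p∣ p q = ≃-trans (∣-∣-cong (solve 2 (λ p q → p :- q := :- (q :- p)) ≃-refl p q)) (∣-p∣≃∣p∣ (q - p))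

  p≤∣p∣ : ∀ p → p ≤ ∣ p ∣
  p≤∣p∣ p with ∣p∣≡p∨∣p∣≡-p p
  ... | inj₁ ∣p∣≡p  = ≤-reflexive (≃-reflexive (sym ∣p∣≡p))
  ... | inj₂ ∣p∣≡-p = ≤-trans p≤0 (0≤∣p∣ p)
    where
    p≤0 : p ≤ 0ℚᵘ
    p≤0 = ≤-respˡ-≃ (neg-involutive p) (neg-mono-≤ (subst (0ℚᵘ ≤_) ∣p∣≡-p (0≤∣p∣ p)))

  p<r-q⇒q+p<r : ∀ q r {p} → p < r - q → q + p < r
  p<r-q⇒q+p<r q r h = <-respʳ-≃ (solve 2 (λ q r → q :+ (r :- q) := r) ≃-refl q r) (+-monoʳ-< q h)

  p≤r-q⇒q+p≤r : ∀ q r {p} → p ≤ r - q → q + p ≤ r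
  p≤r-q⇒q+p≤r q r h = ≤-respʳ-≃ (solve 2 (λ q r → q :+ (r :- q) := r) ≃-refl q r) (+-monoʳ-≤ q h)

  p<q⇒0<q-p : ∀ {p q} → p < q → 0ℚᵘ < q - p
  p<q⇒0<q-p {p} h = <-respˡ-≃ (+-inverseʳ p) (+-monoˡ-< (- p) h)

  ∣p-q∣≤r⇒p≤q+r : ∀ {p q r} → ∣ p - q ∣ ≤ r → p ≤ q + r
  ∣p-q∣≤r⇒p≤q+r {p} {q} h =
    ≤-respˡ-≃ (solve 2 (λ p q → q :+ (p :- q) := p) ≃-refl p q) (+-monoʳ-≤ q (≤-trans (p≤∣p∣ (p - q)) h))

  ∣p-q∣≤r⇒q-r≤p : ∀ {p q r} → ∣ p - q ∣ ≤ r → q - r ≤ p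
  ∣p-q∣≤r⇒q-r≤p {p} {q} {r} h =
    ≤-respʳ-≃ (solve 2 (λ p r → r :+ (p :- r) := p) ≃-refl p r)
      (≤-respˡ-≃ (solve 3 (λ p q r → (q :- p) :+ (p :- r) := q :- r) ≃-refl p q r)
        (+-monoˡ-≤ (p - r) (≤-trans (p≤∣p∣ (q - p)) (≤-respˡ-≃ (∣p-q∣≃∣q-p∣ p q) h))))

  +*+≤⇒ℕ : ∀ {a b c d} → + a ℤ.* + b ℤ.≤ + c ℤ.* + d → a ℕ.* b ℕ.≤ c ℕ.* d
  +*+≤⇒ℕ {a} {b} {c} {d} h = ℤₚ.drop‿+≤+ (subst₂ ℤ._≤_ (sym (ℤₚ.pos-* a b)) (sym (ℤₚ.pos-* c d)) h)

  +*+<⇒ℕ : ∀ {a b c d} → + a ℤ.* + b ℤ.< + c ℤ.* + d → a ℕ.* b ℕ.< c ℕ.* d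
  +*+<⇒ℕ {a} {b} {c} {d} h = ℤₚ.drop‿+<+ (subst₂ ℤ._<_ (sym (ℤₚ.pos-* a b)) (sym (ℤₚ.pos-* c d)) h)

  ℕ<⇒+*+< : ∀ {a b c d} → a ℕ.* b ℕ.< c ℕ.* d → + a ℤ.* + b ℤ.< + c ℤ.* + d
  ℕ<⇒+*+< {a} {b} {c} {d} h = subst₂ ℤ._<_ (ℤₚ.pos-* a b) (ℤₚ.pos-* c d) (ℤ.+<+ h)

  inv-pos : ∀ n → 0ℚᵘ < inv n
  inv-pos n = *<* (ℤ.+<+ (s≤s z≤n))

  archimedean : ∀ {q} → 0ℚᵘ < q → ∃ λ n → inv n < q
  archimedean {mkℚᵘ +[1+ k ] e} _ = suc e , *<* (ℕ<⇒+*+< {1} {suc e} {suc k} {suc (suc e)}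
    (ℕₚ.≤-trans (s≤s (ℕₚ.≤-reflexive (ℕₚ.*-identityˡ (suc e)))) (ℕₚ.m≤n*m (suc (suc e)) (suc k))))
  archimedean {mkℚᵘ (+ 0)    e} (*<* (ℤ.+<+ ()))
  archimedean {mkℚᵘ -[1+ k ] e} (*<* ())

  inv-half : ∀ m → inv (m ℕ.+ suc m) + inv (m ℕ.+ suc m) ≃ inv m
  inv-half m = *≡* (begin
    (+ 1 ℤ.* + s ℤ.+ + 1 ℤ.* + s) ℤ.* + suc m  ≡⟨ cong₂ (λ a b → (a ℤ.+ b) ℤ.* + suc m) (ℤₚ.*-identityˡ (+ s)) (ℤₚ.*-identityˡ (+ s)) ⟩
    + (s ℕ.+ s) ℤ.* + suc m                     ≡⟨ ℤₚ.pos-* (s ℕ.+ s) (suc m) ⟨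
    + ((s ℕ.+ s) ℕ.* suc m)                     ≡⟨ cong +_ (2s[1+m]≡s*s m) ⟩
    + (s ℕ.* s)                                 ≡⟨ ℤₚ.*-identityˡ (+ (s ℕ.* s)) ⟨
    + 1 ℤ.* + (s ℕ.* s)                         ∎)
    where
    open ≡-Reasoning
    s = suc (m ℕ.+ suc m)
    2s[1+m]≡s*s : ∀ m → (suc (m ℕ.+ suc m) ℕ.+ suc (m ℕ.+ suc m)) ℕ.* suc m ≡ suc (m ℕ.+ suc m) ℕ.* suc (m ℕ.+ suc m)
    2s[1+m]≡s*s = solve-∀

  ∃-half : ∀ {q} → 0ℚᵘ < q → ∃ λ m → inv m + inv m < q
  ∃-half 0<q with archimedean 0<q
  ... | n , inv[n]<q = n ℕ.+ suc n , <-respˡ-≃ (≃-sym (inv-half n)) inv[n]<q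

  0<⊓ : ∀ {p q} → 0ℚᵘ < p → 0ℚᵘ < q → 0ℚᵘ < p ⊓ q
  0<⊓ {p} {q} 0<p 0<q with ⊓-sel p q
  ... | inj₁ p⊓q≃p = <-respʳ-≃ (≃-sym p⊓q≃p) 0<p
  ... | inj₂ p⊓q≃q = <-respʳ-≃ (≃-sym p⊓q≃q) 0<q

  -- Bishop reals

  ∣p-p∣≃0 : ∀ p → ∣ p - p ∣ ≃ 0ℚᵘ
  ∣p-p∣≃0 p = ∣-∣-cong (+-inverseʳ p)

  const : ℚᵘ → ℝ
  const q = record
    { seq = λ _ → q
    ; reg = λ m n → ≤-respˡ-≃ (≃-sym (∣p-p∣≃0 q))
                      (<⇒≤ (<-respˡ-≃ (+-identityˡ 0ℚᵘ) (+-mono-< (inv-pos m) (inv-pos n))))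
    }

  DistLt⇒∣-∣< : ∀ x {b ε} m → DistLt b x ε → ∣ b - seq x m ∣ < inv m + ε
  DistLt⇒∣-∣< x {b} {ε} m (n , h) = begin-strict
    ∣ b - xₘ ∣                    ≤⟨ ∣p-r∣≤∣p-q∣+∣q-r∣ b xₙ xₘ ⟩
    ∣ b - xₙ ∣ + ∣ xₙ - xₘ ∣      ≤⟨ +-monoʳ-≤ ∣ b - xₙ ∣ (reg x n m) ⟩
    ∣ b - xₙ ∣ + (inv n + inv m)  ≃⟨ solve 3 (λ d i j → d :+ (i :+ j) := j :+ (d :+ i)) ≃-refl ∣ b - xₙ ∣ (inv n) (inv m) ⟩
    inv m + (∣ b - xₙ ∣ + inv n)  <⟨ +-monoʳ-< (inv m) (p<r-q⇒q+p<r ∣ b - xₙ ∣ ε h) ⟩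
    inv m + ε                     ∎
    where
    open ≤-Reasoning
    xₘ = seq x m
    xₙ = seq x n

  ¬DistLt : ∀ x {b ε} m → inv m + ε ≤ ∣ b - seq x m ∣ → ¬ DistLt b x ε
  ¬DistLt x {b} {ε} m far near = <-irrefl ≃-refl (<-≤-trans (DistLt⇒∣-∣< x {b} {ε} m near) far)

  DistLt-pair : ∀ x {b₁ b₂ ε₁ ε₂} → DistLt b₁ x ε₁ → DistLt b₂ x ε₂ → ∣ b₁ - b₂ ∣ < ε₁ + ε₂
  DistLt-pair x {b₁} {b₂} {ε₁} {ε₂} (n , h) near₂ = begin-strict
    ∣ b₁ - b₂ ∣                 ≤⟨ ∣p-r∣≤∣p-q∣+∣q-r∣ b₁ xₙ b₂ ⟩
    ∣ b₁ - xₙ ∣ + ∣ xₙ - b₂ ∣   ≃⟨ +-congʳ ∣ b₁ - xₙ ∣ (∣p-q∣≃∣q-p∣ xₙ b₂) ⟩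
    ∣ b₁ - xₙ ∣ + ∣ b₂ - xₙ ∣   <⟨ +-monoʳ-< ∣ b₁ - xₙ ∣ (DistLt⇒∣-∣< x {b₂} {ε₂} n near₂) ⟩
    ∣ b₁ - xₙ ∣ + (inv n + ε₂)  ≃⟨ +-assoc ∣ b₁ - xₙ ∣ (inv n) ε₂ ⟨
    ∣ b₁ - xₙ ∣ + inv n + ε₂    <⟨ +-monoˡ-< ε₂ (p<r-q⇒q+p<r ∣ b₁ - xₙ ∣ ε₁ h) ⟩
    ε₁ + ε₂                     ∎
    where
    open ≤-Reasoning
    xₙ = seq x n

  DistLt-resp-≃ : ∀ {x b b′ ε} → b ≃ b′ → DistLt b x ε → DistLt b′ x ε
  DistLt-resp-≃ {x} {ε = ε} b≃b′ (n , h) = n , <-respʳ-≃ (+-congʳ ε (-‿cong (∣-∣-cong (+-congˡ (- seq x n) b≃b′)))) h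

  DistLt-const : ∀ {b q ε} → DistLt b (const q) ε → ∣ b - q ∣ < ε
  DistLt-const {b} {q} {ε} (n , h) =
    <-trans (<-respˡ-≃ (+-identityʳ ∣ b - q ∣) (+-monoʳ-< ∣ b - q ∣ (inv-pos n))) (p<r-q⇒q+p<r ∣ b - q ∣ ε h)

  -- Uniformly discrete sets

  _∈[_,_] : ℚᵘ → ℚᵘ → ℚᵘ → Set
  r ∈[ lo , hi ] = lo ≤ r × r ≤ hi

  ∣p-q∣≤r⇒p∈[q-r,q+r] : ∀ {p q r} → ∣ p - q ∣ ≤ r → p ∈[ q - r , q + r ]
  ∣p-q∣≤r⇒p∈[q-r,q+r] h = ∣p-q∣≤r⇒q-r≤p h , ∣p-q∣≤r⇒p≤q+r h

  UniformlyDiscreteOnCompacts : (ℚᵘ → Set) → Set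
  UniformlyDiscreteOnCompacts B = ∀ lo hi → 0ℚᵘ < lo → ∃ λ g → 0ℚᵘ < g ×
    (∀ {r s} → B r → B s → r ∈[ lo , hi ] → s ∈[ lo , hi ] → ∣ r - s ∣ < g → r ≃ s)

  Isolated : (ℚᵘ → Set) → ℚᵘ → Set
  Isolated B q = ∃ λ ε → 0ℚᵘ < ε × (∀ r → B r → ∣ r - q ∣ < ε → r ≃ q)

  discrete⇒isolated : ∀ {B} → UniformlyDiscreteOnCompacts B → ∀ {q} → B q → 0ℚᵘ < q → Isolated B q
  discrete⇒isolated discrete {q} Bq 0<q with archimedean 0<q
  ... | k , inv[k]<q with discrete (q - inv k) (q + inv k) (p<q⇒0<q-p inv[k]<q)
  ... | g , 0<g , gap = inv k ⊓ g , 0<⊓ (inv-pos k) 0<g , λ r Br ∣r-q∣<ε →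
    gap Br Bq (∣p-q∣≤r⇒p∈[q-r,q+r] (<⇒≤ (<-≤-trans ∣r-q∣<ε (p⊓q≤p (inv k) g))))
              (∣p-q∣≤r⇒p∈[q-r,q+r] (≤-respˡ-≃ (≃-sym (∣p-p∣≃0 q)) (<⇒≤ (inv-pos k))))
              (<-≤-trans ∣r-q∣<ε (p⊓q≤q (inv k) g))

  -- A dense B approximates the real q + η to within η, which pulls a point of B onto q.
  isolated⇒¬dense : ∀ {B q} → B q → 0ℚᵘ < q → Isolated B q → ¬ DenseInPos B
  isolated⇒¬dense {B} {q} Bq 0<q (ε , 0<ε , isolated) dense with ∃-half 0<ε
  ... | m , 2η<ε with dense (const (q + inv m)) (archimedean 0<q+η) (inv m) (inv-pos m)
    where 0<q+η = <-trans 0<q (<-respˡ-≃ (+-identityʳ q) (+-monoʳ-< q (inv-pos m)))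
  ... | b , Bb , near = <-irrefl ≃-refl (<-respˡ-≃ ∣b-y∣≃η ∣b-y∣<η)
    where
    η = inv m
    y = q + η
    ∣y-q∣≃η : ∣ y - q ∣ ≃ η
    ∣y-q∣≃η = ∣-∣-cong (solve 2 (λ q η → (q :+ η) :- q := η) ≃-refl q η)
    ∣b-y∣<η : ∣ b - y ∣ < η
    ∣b-y∣<η = DistLt-const {b} {y} near
    b≃q : b ≃ q
    b≃q = isolated b Bb (begin-strict
      ∣ b - q ∣              ≤⟨ ∣p-r∣≤∣p-q∣+∣q-r∣ b y q ⟩
      ∣ b - y ∣ + ∣ y - q ∣  <⟨ +-mono-<-≤ ∣b-y∣<η (≤-reflexive ∣y-q∣≃η) ⟩
      η + η                  <⟨ 2η<ε ⟩
      ε                      ∎)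
      where open ≤-Reasoning
    ∣b-y∣≃η : ∣ b - y ∣ ≃ η
    ∣b-y∣≃η = ≃-trans (∣-∣-cong (+-congˡ (- y) b≃q)) (≃-trans (∣p-q∣≃∣q-p∣ q y) ∣y-q∣≃η)

  positive⇒window : ∀ x → Positive x → ∃ λ lo → ∃ λ hi → ∃ λ δ → 0ℚᵘ < lo × 0ℚᵘ < δ ×
                    (∀ {b ε} → ε ≤ δ → DistLt b x ε → b ∈[ lo , hi ])
  positive⇒window x (n₀ , inv[n₀]<c) with archimedean (p<q⇒0<q-p inv[n₀]<c)
  ... | k , inv[k]<c-inv[n₀] =
    c - R , c + R , inv k , p<q⇒0<q-p (p<r-q⇒q+p<r (inv n₀) c inv[k]<c-inv[n₀]) , inv-pos k ,
    λ {b} {ε} ε≤inv[k] near → ∣p-q∣≤r⇒p∈[q-r,q+r] (<⇒≤ (<-≤-trans (DistLt⇒∣-∣< x {b} {ε} n₀ near) (+-monoʳ-≤ (inv n₀) ε≤inv[k])))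
    where
    c = seq x n₀
    R = inv n₀ + inv k

  -- b₂ is chosen closer to x than b₁ is, yet both lie in one window and are closer to each
  -- other than the gap there, so b₂ ≃ b₁.
  discrete⇒¬AccPoint : ∀ {B} → UniformlyDiscreteOnCompacts B → ∀ x → ¬ AccPoint B x
  discrete⇒¬AccPoint discrete x (positive , acc) =
    let lo , hi , δ , 0<lo , 0<δ , window = positive⇒window x positive
        g , 0<g , gap = discrete lo hi 0<lo
        m , 2inv[m]<g = ∃-half 0<g
        ε₁ = inv m ⊓ δ
        ε₁≤δ = p⊓q≤q (inv m) δ
        ε₁≤inv[m] = p⊓q≤p (inv m) δ
        b₁ , Bb₁ , (m₁ , apart) , near₁ = acc ε₁ (0<⊓ (inv-pos m) 0<δ)
        d₁ = ∣ b₁ - seq x m₁ ∣ - inv m₁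
        ε₂ = ε₁ ⊓ d₁
        ε₂≤ε₁ = p⊓q≤p ε₁ d₁
        b₂ , Bb₂ , _ , near₂ = acc ε₂ (0<⊓ (0<⊓ (inv-pos m) 0<δ) (p<q⇒0<q-p apart))
        b₁≃b₂ = gap Bb₁ Bb₂ (window {b₁} {ε₁} ε₁≤δ near₁) (window {b₂} {ε₂} (≤-trans ε₂≤ε₁ ε₁≤δ) near₂)
          (<-≤-trans (DistLt-pair x {b₁} {b₂} {ε₁} {ε₂} near₁ near₂) (≤-trans (+-mono-≤ ε₁≤inv[m] (≤-trans ε₂≤ε₁ ε₁≤inv[m])) (<⇒≤ 2inv[m]<g)))
    in ¬DistLt x {b₁} {ε₂} m₁ (p≤r-q⇒q+p≤r (inv m₁) ∣ b₁ - seq x m₁ ∣ (p⊓q≤q ε₁ d₁)) (DistLt-resp-≃ {x} {b₂} {b₁} {ε₂} (≃-sym b₁≃b₂) near₂)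

module DiagonalRatios where

  open Rationals
  open Primes using (diag-mono; Diag⇒≥1; diag-growth; diag-comparable)
  open import Data.Nat as ℕ using (suc; zero; s≤s; z≤n)
  import Data.Nat.Properties as ℕₚ
  open import Data.Integer as ℤ using (+_; +[1+_]; -[1+_])
  import Data.Integer.Properties as ℤₚ
  open import Data.Rational.Unnormalised.Base
    using (mkℚᵘ; *≡*; *≤*; *<*; 0ℚᵘ; ∣_∣; _-_; _≃_; _≤_; _<_)
  open import Data.Rational.Unnormalised.Properties
    using (≃-refl; ≃-sym; ≃-trans; ≤-respˡ-≃; ≤-respʳ-≃; <-respˡ-≃; <-respʳ-≃; ∣-∣-cong; +-cong; -‿cong; ≰⇒>)
  open import Data.Product using (∃; _×_; _,_)
  open import Data.Sum using (inj₁; inj₂)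
  open import Data.Empty using (⊥-elim)
  open import Relation.Nullary using (¬_)
  open import Relation.Binary.PropositionalEquality using (_≡_; refl; sym; trans; cong; subst)

  ratio≤⇒bounded : ∀ q → ∃ λ U → ∀ {a B} → 1 ℕ.≤ B → ratio a B ≤ q → a ℕ.≤ U ℕ.* B
  ratio≤⇒bounded (mkℚᵘ (+ n) e) = n , bounded
    where
    bounded : ∀ {a B} → 1 ℕ.≤ B → ratio a B ≤ mkℚᵘ (+ n) e → a ℕ.≤ n ℕ.* B
    bounded {a} {suc b} _ (*≤* a[1+e]≤n[1+b]) = ℕₚ.≤-trans (ℕₚ.m≤m*n a (suc e)) (+*+≤⇒ℕ {a} {suc e} {n} {suc b} a[1+e]≤n[1+b])
  ratio≤⇒bounded (mkℚᵘ -[1+ n ] e) = 0 , bounded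
    where
    bounded : ∀ {a B} → 1 ℕ.≤ B → ratio a B ≤ mkℚᵘ -[1+ n ] e → a ℕ.≤ 0
    bounded {a} {suc b} _ (*≤* le) with subst (ℤ._≤ _) (sym (ℤₚ.pos-* a (suc e))) le
    ... | ()

  ≤ratio⇒bounded : ∀ q → 0ℚᵘ < q → ∃ λ U → ∀ {a B} → 1 ℕ.≤ B → q ≤ ratio a B → B ℕ.≤ U ℕ.* a
  ≤ratio⇒bounded (mkℚᵘ +[1+ k ] e) _ = suc e , bounded
    where
    bounded : ∀ {a B} → 1 ℕ.≤ B → mkℚᵘ +[1+ k ] e ≤ ratio a B → B ℕ.≤ suc e ℕ.* a
    bounded {a} {suc b} _ (*≤* [1+k][1+b]≤a[1+e]) = begin
      suc b              ≤⟨ ℕₚ.m≤n*m (suc b) (suc k) ⟩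
      suc k ℕ.* suc b    ≤⟨ +*+≤⇒ℕ {suc k} {suc b} {a} {suc e} [1+k][1+b]≤a[1+e] ⟩
      a ℕ.* suc e        ≡⟨ ℕₚ.*-comm a (suc e) ⟩
      suc e ℕ.* a        ∎
      where open ℕₚ.≤-Reasoning
  ≤ratio⇒bounded (mkℚᵘ (+ 0)    e) (*<* (ℤ.+<+ ()))
  ≤ratio⇒bounded (mkℚᵘ -[1+ k ] e) (*<* ())

  ratio-pos : ∀ {a B} → 1 ℕ.≤ a → 1 ℕ.≤ B → 0ℚᵘ < ratio a B
  ratio-pos {suc a} {suc b} _ _ = *<* (ℕ<⇒+*+< {0} {suc b} {suc a} {1} (s≤s z≤n))

  ratio-self : ∀ {a} → 1 ℕ.≤ a → ratio a a ≃ ratio 1 1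
  ratio-self {suc a} _ = *≡* (ℤₚ.*-comm (+ suc a) (+ 1))

  ratio-gap : ∀ {D a b c d} → 1 ℕ.≤ b → b ℕ.≤ D → 1 ℕ.≤ d → d ℕ.≤ D →
              ∣ ratio a b - ratio c d ∣ < inv (D ℕ.* D) → ratio a b ≃ ratio c d
  ratio-gap {D} {a} {suc b} {c} {suc d} _ b≤D _ d≤D (*<* h) =
    *≡* (ℤₚ.i-j≡0⇒i≡j (+ a ℤ.* + suc d) (+ c ℤ.* + suc b)
          (trans (cong (λ z → + a ℤ.* + suc d ℤ.+ z) (ℤₚ.neg-distribˡ-* (+ c) (+ suc b))) (ℤₚ.∣i∣≡0⇒i≡0 ∣num∣≡0)))
    where
    num = + a ℤ.* + suc d ℤ.+ ℤ.- (+ c) ℤ.* + suc b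
    h′ : + ℤ.∣ num ∣ ℤ.* + suc (D ℕ.* D) ℤ.< + 1 ℤ.* + (suc b ℕ.* suc d)
    h′ = h
    ∣num∣≡0 : ℤ.∣ num ∣ ≡ 0
    ∣num∣≡0 with ℤ.∣ num ∣ | +*+<⇒ℕ {ℤ.∣ num ∣} {suc (D ℕ.* D)} {1} {suc b ℕ.* suc d} h′
    ... | zero  | _  = refl
    ... | suc n | lt = ⊥-elim (ℕₚ.<⇒≱ lt (begin
      1 ℕ.* (suc b ℕ.* suc d)  ≡⟨ ℕₚ.*-identityˡ _ ⟩
      suc b ℕ.* suc d          ≤⟨ ℕₚ.*-mono-≤ b≤D d≤D ⟩
      D ℕ.* D                  ≤⟨ ℕₚ.n≤1+n _ ⟩
      suc (D ℕ.* D)            ≤⟨ ℕₚ.m≤n*m _ (suc n) ⟩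
      suc n ℕ.* suc (D ℕ.* D)  ∎))
      where open ℕₚ.≤-Reasoning

  window-denominators : ∀ lo hi → 0ℚᵘ < lo → ∃ λ D → ∀ {r} → RatioSet Diag r → r ∈[ lo , hi ] →
                        ∃ λ a → ∃ λ B → 1 ℕ.≤ B × B ℕ.≤ D × r ≃ ratio a B
  window-denominators lo hi 0<lo with ratio≤⇒bounded hi | ≤ratio⇒bounded lo 0<lo
  ... | U₁ , bounded-above | U₂ , bounded-below with diag-comparable (U₁ ℕ.+ U₂)
  ... | K , comparable = suc (diag K) , denominator
    where
    denominator : ∀ {r} → RatioSet Diag r → r ∈[ lo , hi ] → ∃ λ a → ∃ λ B → 1 ℕ.≤ B × B ℕ.≤ suc (diag K) × r ≃ ratio a B
    denominator (_ , _ , (i , _ , refl) , Dj@(j , _ , refl) , r≃) (lo≤r , r≤hi)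
      with comparable i j
             (ℕₚ.≤-trans (bounded-above (Diag⇒≥1 Dj) (≤-respˡ-≃ r≃ r≤hi)) (ℕₚ.*-monoˡ-≤ (diag j) (ℕₚ.m≤m+n U₁ U₂)))
             (ℕₚ.≤-trans (bounded-below (Diag⇒≥1 Dj) (≤-respʳ-≃ r≃ lo≤r)) (ℕₚ.*-monoˡ-≤ (diag i) (ℕₚ.m≤n+m U₂ U₁)))
    ... | inj₁ refl = 1 , 1 , s≤s z≤n , s≤s z≤n , ≃-trans r≃ (ratio-self (Diag⇒≥1 Dj))
    ... | inj₂ j≤K  = diag i , diag j , Diag⇒≥1 Dj , ℕₚ.m≤n⇒m≤1+n (diag-mono j≤K) , r≃

  ratioSet-Diag-discrete : UniformlyDiscreteOnCompacts (RatioSet Diag)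
  ratioSet-Diag-discrete lo hi 0<lo with window-denominators lo hi 0<lo
  ... | D , denominator = inv (D ℕ.* D) , inv-pos (D ℕ.* D) , separated
    where
    separated : ∀ {r s} → RatioSet Diag r → RatioSet Diag s → r ∈[ lo , hi ] → s ∈[ lo , hi ] →
                ∣ r - s ∣ < inv (D ℕ.* D) → r ≃ s
    separated Rr Rs r∈ s∈ close with denominator Rr r∈ | denominator Rs s∈
    ... | a , b , 1≤b , b≤D , r≃a/b | c , d , 1≤d , d≤D , s≃c/d =
      ≃-trans r≃a/b (≃-trans (ratio-gap 1≤b b≤D 1≤d d≤D (<-respˡ-≃ (∣-∣-cong (+-cong r≃a/b (-‿cong s≃c/d))) close))
                             (≃-sym s≃c/d))

  ratioSet-Diag-pos : ∀ {q} → RatioSet Diag q → 0ℚᵘ < q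
  ratioSet-Diag-pos (_ , _ , Da , Db , q≃) = <-respʳ-≃ (≃-sym q≃) (ratio-pos (Diag⇒≥1 Da) (Diag⇒≥1 Db))

  1∈ratioSet-Diag : RatioSet Diag (ratio 2 2)
  1∈ratioSet-Diag = 2 , 2 , (1 , ℕₚ.≤-refl , refl) , (1 , ℕₚ.≤-refl , refl) , ≃-refl

  ratioSet-Diag-isolated : ∀ q → RatioSet Diag q → Isolated (RatioSet Diag) q
  ratioSet-Diag-isolated q Rq = discrete⇒isolated ratioSet-Diag-discrete Rq (ratioSet-Diag-pos Rq)

  Diag-not-RDense : ¬ RDense Diag
  Diag-not-RDense = isolated⇒¬dense 1∈ratioSet-Diag (ratioSet-Diag-pos 1∈ratioSet-Diag)
                      (ratioSet-Diag-isolated (ratio 2 2) 1∈ratioSet-Diag)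

  diag-ratio→∞ : ∀ M → ∃ λ K → ∀ k → 1 ℕ.≤ k → K ℕ.≤ k → M < ratio (diag (suc k)) (diag k)
  diag-ratio→∞ M with ratio≤⇒bounded M
  ... | U , bounded with diag-growth U
  ... | K , growth = K , λ k 1≤k K≤k →
    ≰⇒> λ ratio≤M → ℕₚ.<⇒≱ (growth k K≤k) (bounded (Diag⇒≥1 (k , 1≤k , refl)) ratio≤M)

open DiagonalRatios using (Diag-not-RDense; diag-ratio→∞; ratioSet-Diag-isolated; ratioSet-Diag-discrete)
open Rationals using (discrete⇒¬AccPoint)
open import Data.Nat using (ℕ; suc; _≤_)
open import Data.Product using (∃; _×_; _,_)
open import Relation.Nullary using (¬_)
open import Data.Rational.Unnormalised.Base using (ℚᵘ; 0ℚᵘ; ∣_∣; _-_; _<_; _≃_)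

theorem12 : ¬ RDense Diag
    × ((M : ℚᵘ) → ∃ λ K → (k : ℕ) → 1 ≤ k → K ≤ k → M < ratio (diag (suc k)) (diag k))
    × ((q : ℚᵘ) → RatioSet Diag q → ∃ λ ε → 0ℚᵘ < ε
         × ((r : ℚᵘ) → RatioSet Diag r → ∣ r - q ∣ < ε → r ≃ q))
    × ((x : ℝ) → ¬ AccPoint (RatioSet Diag) x)
theorem12 = Diag-not-RDense , diag-ratio→∞ , ratioSet-Diag-isolated , discrete⇒¬AccPoint ratioSet-Diag-discrete
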